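{- Let $n>3$ and let $mK_n$ be the mixed complete graph. Then $\det A(mK_n)=0$ if $n$ is even and $\det A(mK_n)=n-2$ if $n$ is odd.
   Context: The directed cycle $dC_n$ has vertices $v_1,\dots,v_n$ and arcs $v_i\to v_{i+1}$ ($1\le i\le n-1$) and $v_n\to v_1$. The mixed complete graph $mK_n$ ($n>3$) is obtained from $dC_n$ by adding both arcs $v_i\to v_j$ and $v_j\to v_i$ for every pair $v_i,v_j$ non-adjacent in the underlying cycle. Its adjacency matrix $A(mK_n)$ has $(i,j)$ entry $1$ if there is an arc $v_i\to v_j$ and $0$ otherwise. -}

module Defs where

open import Data.Nat as ℕ using (ℕ; zero; suc)
open import Data.Nat.DivMod using (_%_)
open import Data.Fin as Fin using (Fin; toℕ; punchIn)
open import Data.Integer as ℤ using (ℤ; +_; -_; _*_; _+_)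
open import Data.Bool using (if_then_else_)
open import Relation.Nullary.Decidable using (⌊_⌋)

Matrix : ℕ → Set
Matrix n = Fin n → Fin n → ℤ

∑ : ∀ {n} → (Fin n → ℤ) → ℤ
∑ {zero}  f = + 0
∑ {suc n} f = f Fin.zero + ∑ (λ i → f (Fin.suc i))

sgn : ℕ → ℤ
sgn k = if ⌊ k % 2 ℕ.≟ 0 ⌋ then + 1 else - (+ 1)

det : ∀ {n} → Matrix n → ℤ
det {zero}  M = + 1
det {suc n} M =
  ∑ (λ j → sgn (toℕ j) * (M Fin.zero j * det (λ r c → M (Fin.suc r) (punchIn j c))))

open import Relation.Binary.PropositionalEquality using (_≡_)

-- Vertices v_1..v_n are represented by Fin n as 0..n-1 (v_{i+1} ↦ i).
-- Arc of the directed cycle dC_n: i → i+1 (mod n).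
dCArc : (n : ℕ) → Fin n → Fin n → Set
dCArc (suc n) i j = toℕ j ≡ (suc (toℕ i)) % suc n

-- Adjacency matrix of the mixed complete graph mK_n: arc i → j iff
-- it is an arc of dC_n, or i ≠ j and i, j are non-adjacent in the
-- underlying cycle (neither i → j nor j → i is a cycle arc).
open import Relation.Nullary using (Dec; yes; no)
import Data.Nat.Properties as ℕP
import Data.Fin.Properties as FinP

dCArc? : (n : ℕ) → (i j : Fin n) → Dec (dCArc n i j)
dCArc? (suc n) i j = toℕ j ℕ.≟ (suc (toℕ i)) % suc n

adjMK : (n : ℕ) → Matrix n
adjMK n i j with dCArc? n i j
... | yes _ = + 1
... | no _ with i Fin.≟ j | dCArc? n j i
...   | yes _ | _     = + 0
...   | no _  | yes _ = + 0
...   | no _  | no _  = + 1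

module Submission where

-- Every column of A = A(mK_n) sums to n − 2, since column j has zeros exactly in rows j and j + 1 (mod n).
-- Adding all rows to the first one gives det A = (n − 2) · det A′, where A′ is A with first row all ones;
-- subtracting that row from the others leaves the matrix B whose first row is all ones and whose row
-- i + 1 is −(e_i + e_{i+1}). As row 0 is only relevant modulo the other rows, the ones vector may be
-- replaced by the indicator of {0, …, t − 1} for any t ≡ n (mod 2): by 0 when n is even, and by e_0
-- when n is odd, whose cofactor is a lower-triangular determinant with diagonal −1, i.e. (−1)^(n−1) = 1.
-- Multilinearity and the vanishing on a repeated row follow from the Laplace expansion along the first
-- row; that swapping the first two rows negates the determinant comes from the antisymmetry of the
-- complementary cofactors of a pair of columns.

open import Defs
open import Data.Bool using (if_then_else_)
open import Data.Fin as Fin using (Fin; zero; suc; toℕ; punchIn; punchOut)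
import Data.Fin.Properties as FinP
open import Data.Integer as ℤ using (ℤ; +_; -_; _*_; _+_; _-_)
import Data.Integer.Properties as ℤP
open import Data.Integer.Tactic.RingSolver using (solve-∀)
open import Data.Nat as ℕ using (ℕ; zero; suc; _>_; _∸_)
import Data.Nat.Properties as ℕP
open import Data.Nat.DivMod using (_%_; _/_; m<n⇒m%n≡m; n%n≡0; m%n<n; m≡m%n+[m/n]*n)
open import Data.Nat.Divisibility using (_∣_; divides; m%n≡0⇒n∣m)
open import Data.Product using (_×_; _,_)
open import Data.Sum using (_⊎_; inj₁; inj₂)
open import Data.Vec.Functional using (updateAt)
open import Data.Vec.Functional.Properties
  using (updateAt-updates; updateAt-minimal; updateAt-id-local; map-updateAt)
open import Function using (_∘_; const)
open import Relation.Binary.PropositionalEquality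
  using (_≡_; _≢_; _≗_; refl; sym; trans; cong; cong₂; cong-app; subst; module ≡-Reasoning)
open import Relation.Nullary using (¬_; Dec; yes; no; does; contradiction)
open import Relation.Nullary.Decidable using (dec-true; dec-false)
open import Algebra.Properties.Semiring.Sum ℤP.+-*-semiring
  using (sum; sum-cong-≗; sum-remove; ∑-distrib-+; ∑-comm; *-distribˡ-sum; *-distribʳ-sum; sum-replicate-zero)

-- Laplace expansion along the first row

∑≡sum : ∀ {n} (f : Fin n → ℤ) → ∑ f ≡ sum f
∑≡sum {zero}  f = refl
∑≡sum {suc n} f = cong (_+_ (f zero)) (∑≡sum (f ∘ suc))

sum-zero : ∀ {n} {f : Fin n → ℤ} → (∀ i → f i ≡ + 0) → sum f ≡ + 0
sum-zero {n} f≡0 = trans (sum-cong-≗ f≡0) (sum-replicate-zero n)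

sum-linear : ∀ {n} (f g : Fin n → ℤ) c → sum (λ i → f i + c * g i) ≡ sum f + c * sum g
sum-linear f g c = trans (∑-distrib-+ f (λ i → c * g i)) (cong (_+_ (sum f)) (sym (*-distribˡ-sum c g)))

minor : ∀ {n} → Matrix (suc n) → Fin (suc n) → Matrix n
minor M j r c = M (suc r) (punchIn j c)

cofactor : ∀ {n} → Matrix (suc n) → Fin (suc n) → ℤ
cofactor M j = sgn (toℕ j) * det (minor M j)

det-expansion : ∀ {n} (M : Matrix (suc n)) → det M ≡ sum (λ j → M zero j * cofactor M j)
det-expansion M = trans (∑≡sum (λ j → sgn (toℕ j) * (M zero j * det (minor M j))))
  (sum-cong-≗ λ j → reorder (sgn (toℕ j)) (M zero j) (det (minor M j)))
  where
  reorder : ∀ s m d → s * (m * d) ≡ m * (s * d)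
  reorder = solve-∀

det-cong : ∀ {n} {M N : Matrix n} → (∀ i → M i ≗ N i) → det M ≡ det N
det-cong {zero}  M≗N = refl
det-cong {suc n} M≗N = ∑-cong' λ j → cong₂ (λ x d → sgn (toℕ j) * (x * d)) (M≗N zero j)
  (det-cong λ r c → M≗N (suc r) (punchIn j c))
  where
  ∑-cong' : ∀ {m} {f g : Fin m → ℤ} → f ≗ g → ∑ f ≡ ∑ g
  ∑-cong' {f = f} {g} f≗g = trans (∑≡sum f) (trans (sum-cong-≗ f≗g) (sym (∑≡sum g)))

det-minors-vanish : ∀ {n} (M : Matrix (suc n)) → (∀ j → det (minor M j) ≡ + 0) → det M ≡ + 0
det-minors-vanish M minor≡0 = trans (det-expansion M) (sum-zero λ j →
  trans (cong (λ d → M zero j * (sgn (toℕ j) * d)) (minor≡0 j))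
        (trans (cong (M zero j *_) (ℤP.*-zeroʳ (sgn (toℕ j)))) (ℤP.*-zeroʳ (M zero j))))

infixl 6 _[_]≔_
_[_]≔_ : ∀ {n} → Matrix n → Fin n → (Fin n → ℤ) → Matrix n
M [ k ]≔ v = updateAt M k (const v)

det-row₀≔ : ∀ {n} (M : Matrix (suc n)) v → det (M [ zero ]≔ v) ≡ sum (λ j → v j * cofactor M j)
det-row₀≔ M v = det-expansion (M [ zero ]≔ v)

det-row₀≔-cong : ∀ {n} (M : Matrix (suc n)) {v w} → v ≗ w → det (M [ zero ]≔ v) ≡ det (M [ zero ]≔ w)
det-row₀≔-cong M {v} {w} v≗w = det-cong {M = M [ zero ]≔ v} {N = M [ zero ]≔ w} λ { zero → v≗w ; (suc i) j → refl }

det-row₀≔-scale : ∀ {n} (M : Matrix (suc n)) c v → det (M [ zero ]≔ (λ j → c * v j)) ≡ c * det (M [ zero ]≔ v)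
det-row₀≔-scale M c v = begin
  det (M [ zero ]≔ (λ j → c * v j))          ≡⟨ det-row₀≔ M (λ j → c * v j) ⟩
  sum (λ j → c * v j * cofactor M j)          ≡⟨ sum-cong-≗ (λ j → ℤP.*-assoc c (v j) (cofactor M j)) ⟩
  sum (λ j → c * (v j * cofactor M j))        ≡⟨ *-distribˡ-sum c (λ j → v j * cofactor M j) ⟨
  c * sum (λ j → v j * cofactor M j)          ≡⟨ cong (c *_) (det-row₀≔ M v) ⟨
  c * det (M [ zero ]≔ v)                     ∎
  where open ≡-Reasoning

det-lowerTriangular : ∀ {n} d (M : Matrix n) → (∀ i → M i i ≡ d) → (∀ i j → i Fin.< j → M i j ≡ + 0) →
  det M ≡ d ℤ.^ n
det-lowerTriangular {zero}  d M diag upper = refl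
det-lowerTriangular {suc n} d M diag upper = begin
  det M
    ≡⟨ det-expansion M ⟩
  M zero zero * (+ 1 * det (minor M zero)) + sum (λ k → M zero (suc k) * cofactor M (suc k))
    ≡⟨ cong₂ (λ x y → x * y + sum (λ k → M zero (suc k) * cofactor M (suc k))) (diag zero)
         (trans (ℤP.*-identityˡ _) (det-lowerTriangular d (minor M zero) (diag ∘ suc)
           (λ i j i<j → upper (suc i) (suc j) (ℕ.s≤s i<j)))) ⟩
  d * d ℤ.^ n + sum (λ k → M zero (suc k) * cofactor M (suc k))
    ≡⟨ cong (_+_ (d * d ℤ.^ n)) (sum-zero λ k →
         trans (cong (_* cofactor M (suc k)) (upper zero (suc k) (ℕ.s≤s ℕ.z≤n))) (ℤP.*-zeroˡ (cofactor M (suc k)))) ⟩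
  d * d ℤ.^ n + + 0
    ≡⟨ ℤP.+-identityʳ _ ⟩
  d ℤ.^ suc n ∎
  where open ≡-Reasoning

minor-≔ : ∀ {n} (M : Matrix (suc (suc n))) k w j →
  ∀ r → minor (M [ suc k ]≔ w) j r ≗ (minor M j [ k ]≔ (w ∘ punchIn j)) r
minor-≔ M k w j r = cong-app (map-updateAt {f = _∘ punchIn j} (λ _ → refl) (M ∘ suc) k r)

det-linear : ∀ {n} (M : Matrix n) k (u v : Fin n → ℤ) c →
  det (M [ k ]≔ (λ j → u j + c * v j)) ≡ det (M [ k ]≔ u) + c * det (M [ k ]≔ v)
det-linear M zero u v c = begin
  det (M [ zero ]≔ (λ j → u j + c * v j))
    ≡⟨ det-row₀≔ M (λ j → u j + c * v j) ⟩
  sum (λ j → (u j + c * v j) * cofactor M j)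
    ≡⟨ sum-cong-≗ (λ j → distrib c (u j) (v j) (cofactor M j)) ⟩
  sum (λ j → u j * cofactor M j + c * (v j * cofactor M j))
    ≡⟨ sum-linear (λ j → u j * cofactor M j) (λ j → v j * cofactor M j) c ⟩
  sum (λ j → u j * cofactor M j) + c * sum (λ j → v j * cofactor M j)
    ≡⟨ sym (cong₂ (λ x y → x + c * y) (det-row₀≔ M u) (det-row₀≔ M v)) ⟩
  det (M [ zero ]≔ u) + c * det (M [ zero ]≔ v) ∎
  where
  open ≡-Reasoning
  distrib : ∀ c u v x → (u + c * v) * x ≡ u * x + c * (v * x)
  distrib = solve-∀
det-linear {suc (suc n)} M (suc k) u v c = begin
  det (M [ suc k ]≔ w)
    ≡⟨ det-expansion (M [ suc k ]≔ w) ⟩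
  sum (λ j → M zero j * cofactor (M [ suc k ]≔ w) j)
    ≡⟨ sum-cong-≗ (λ j → cong (λ d → M zero j * (sgn (toℕ j) * d)) (cofactor-linear j)) ⟩
  sum (λ j → M zero j * (sgn (toℕ j) * (minorDet u j + c * minorDet v j)))
    ≡⟨ sum-cong-≗ (λ j → distrib c (M zero j) (sgn (toℕ j)) (minorDet u j) (minorDet v j)) ⟩
  sum (λ j → M zero j * cofactor (M [ suc k ]≔ u) j + c * (M zero j * cofactor (M [ suc k ]≔ v) j))
    ≡⟨ sum-linear (λ j → M zero j * cofactor (M [ suc k ]≔ u) j) (λ j → M zero j * cofactor (M [ suc k ]≔ v) j) c ⟩
  sum (λ j → M zero j * cofactor (M [ suc k ]≔ u) j) + c * sum (λ j → M zero j * cofactor (M [ suc k ]≔ v) j)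
    ≡⟨ sym (cong₂ (λ x y → x + c * y) (det-expansion (M [ suc k ]≔ u)) (det-expansion (M [ suc k ]≔ v))) ⟩
  det (M [ suc k ]≔ u) + c * det (M [ suc k ]≔ v) ∎
  where
  open ≡-Reasoning
  w : Fin (suc (suc n)) → ℤ
  w j = u j + c * v j
  minorDet : (Fin (suc (suc n)) → ℤ) → Fin (suc (suc n)) → ℤ
  minorDet x j = det (minor (M [ suc k ]≔ x) j)
  restricted : ∀ x j → minorDet x j ≡ det (minor M j [ k ]≔ (x ∘ punchIn j))
  restricted x j = det-cong (minor-≔ M k x j)
  cofactor-linear : ∀ j → minorDet w j ≡ minorDet u j + c * minorDet v j
  cofactor-linear j = trans (restricted w j) (trans (det-linear (minor M j) k _ _ c)
    (sym (cong₂ (λ x y → x + c * y) (restricted u j) (restricted v j))))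
  distrib : ∀ c m s x y → m * (s * (x + c * y)) ≡ m * (s * x) + c * (m * (s * y))
  distrib = solve-∀

-- A repeated row

sgn-suc : ∀ k → sgn (suc k) ≡ - sgn k
sgn-suc zero    = refl
sgn-suc (suc k) = trans (sym (ℤP.neg-involutive (sgn k))) (cong -_ (sym (sgn-suc k)))

punchIn-punchOut-swap : ∀ {n} (a : Fin (suc (suc n))) c (b≢a : punchIn a c ≢ a) →
  punchIn (punchIn a c) ∘ punchIn (punchOut b≢a) ≗ punchIn a ∘ punchIn c
punchIn-punchOut-swap zero    c       b≢a k             = refl
punchIn-punchOut-swap (suc a) zero    b≢a k             = refl
punchIn-punchOut-swap {suc n} (suc a) (suc c) b≢a zero    = refl
punchIn-punchOut-swap {suc n} (suc a) (suc c) b≢a (suc k) =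
  cong suc (punchIn-punchOut-swap a c (b≢a ∘ cong suc) k)

sgn-punchIn-punchOut : ∀ {n} (a : Fin (suc (suc n))) c (b≢a : punchIn a c ≢ a) →
  sgn (toℕ (punchIn a c)) * sgn (toℕ (punchOut b≢a)) ≡ - (sgn (toℕ a) * sgn (toℕ c))
sgn-punchIn-punchOut zero c b≢a =
  trans (cong (_* + 1) (sgn-suc (toℕ c))) (neg-comm (sgn (toℕ c)))
  where
  neg-comm : ∀ x → - x * + 1 ≡ - (+ 1 * x)
  neg-comm = solve-∀
sgn-punchIn-punchOut (suc a) zero b≢a =
  trans (neg-comm (sgn (toℕ a))) (cong (λ s → - (s * + 1)) (sym (sgn-suc (toℕ a))))
  where
  neg-comm : ∀ x → + 1 * x ≡ - (- x * + 1)
  neg-comm = solve-∀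
sgn-punchIn-punchOut {suc n} (suc a) (suc c) b≢a = begin
  sgn (suc (toℕ (punchIn a c))) * sgn (suc (toℕ (punchOut b≢a′)))
    ≡⟨ cong₂ _*_ (sgn-suc (toℕ (punchIn a c))) (sgn-suc (toℕ (punchOut b≢a′))) ⟩
  - sgn (toℕ (punchIn a c)) * - sgn (toℕ (punchOut b≢a′))
    ≡⟨ neg*neg (sgn (toℕ (punchIn a c))) (sgn (toℕ (punchOut b≢a′))) ⟩
  sgn (toℕ (punchIn a c)) * sgn (toℕ (punchOut b≢a′))
    ≡⟨ sgn-punchIn-punchOut a c b≢a′ ⟩
  - (sgn (toℕ a) * sgn (toℕ c))
    ≡⟨ cong -_ (sym (neg*neg (sgn (toℕ a)) (sgn (toℕ c)))) ⟩
  - (- sgn (toℕ a) * - sgn (toℕ c))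
    ≡⟨ cong -_ (sym (cong₂ _*_ (sgn-suc (toℕ a)) (sgn-suc (toℕ c)))) ⟩
  - (sgn (suc (toℕ a)) * sgn (suc (toℕ c))) ∎
  where
  open ≡-Reasoning
  b≢a′ : punchIn a c ≢ a
  b≢a′ = b≢a ∘ cong suc
  neg*neg : ∀ x y → - x * - y ≡ x * y
  neg*neg = solve-∀

-- R: the rows below the first two; a, b: the columns used by rows 0 and 1.
pairCofactor : ∀ {n} → (Fin n → Fin (suc (suc n)) → ℤ) → Fin (suc (suc n)) → Fin (suc (suc n)) → ℤ
pairCofactor R a b with a Fin.≟ b
... | yes _   = + 0
... | no a≢b = sgn (toℕ a) * (sgn (toℕ (punchOut a≢b)) * det (λ r k → R r (punchIn a (punchIn (punchOut a≢b) k))))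

module _ {n} (R : Fin n → Fin (suc (suc n)) → ℤ) where

  pairCofactor-diag : ∀ a → pairCofactor R a a ≡ + 0
  pairCofactor-diag a with a Fin.≟ a
  ... | yes _   = refl
  ... | no a≢a = contradiction refl a≢a

  pairCofactor-punchIn : ∀ a c →
    pairCofactor R a (punchIn a c) ≡ sgn (toℕ a) * (sgn (toℕ c) * det (λ r k → R r (punchIn a (punchIn c k))))
  pairCofactor-punchIn a c with a Fin.≟ punchIn a c
  ... | yes a≡b = contradiction (sym a≡b) (FinP.punchInᵢ≢i a c)
  ... | no a≢b = cong (λ z → sgn (toℕ a) * (sgn (toℕ z) * det (λ r k → R r (punchIn a (punchIn z k)))))
    (trans (FinP.punchOut-cong a refl) (FinP.punchOut-punchIn a))

  pairCofactor-antisym-punchIn : ∀ a c → pairCofactor R (punchIn a c) a ≡ - pairCofactor R a (punchIn a c)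
  pairCofactor-antisym-punchIn a c with punchIn a c Fin.≟ a
  ... | yes b≡a = contradiction b≡a (FinP.punchInᵢ≢i a c)
  ... | no b≢a = begin
    sgn (toℕ (punchIn a c)) * (sgn (toℕ (punchOut b≢a)) * det (λ r k → R r (punchIn (punchIn a c) (punchIn (punchOut b≢a) k))))
      ≡⟨ cong (λ d → sgn (toℕ (punchIn a c)) * (sgn (toℕ (punchOut b≢a)) * d))
           (det-cong (λ r k → cong (R r) (punchIn-punchOut-swap a c b≢a k))) ⟩
    sgn (toℕ (punchIn a c)) * (sgn (toℕ (punchOut b≢a)) * D)
      ≡⟨ sym (ℤP.*-assoc (sgn (toℕ (punchIn a c))) _ D) ⟩
    sgn (toℕ (punchIn a c)) * sgn (toℕ (punchOut b≢a)) * D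
      ≡⟨ cong (_* D) (sgn-punchIn-punchOut a c b≢a) ⟩
    - (sgn (toℕ a) * sgn (toℕ c)) * D
      ≡⟨ reassoc (sgn (toℕ a)) (sgn (toℕ c)) D ⟩
    - (sgn (toℕ a) * (sgn (toℕ c) * D))
      ≡⟨ cong -_ (sym (pairCofactor-punchIn a c)) ⟩
    - pairCofactor R a (punchIn a c) ∎
    where
    open ≡-Reasoning
    D : ℤ
    D = det (λ r k → R r (punchIn a (punchIn c k)))
    reassoc : ∀ x y d → - (x * y) * d ≡ - (x * (y * d))
    reassoc = solve-∀

  pairCofactor-antisym : ∀ a b → pairCofactor R b a ≡ - pairCofactor R a b
  pairCofactor-antisym a b = by-cases (a Fin.≟ b)
    where
    by-cases : Dec (a ≡ b) → pairCofactor R b a ≡ - pairCofactor R a b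
    by-cases (yes refl) = trans (pairCofactor-diag a) (cong -_ (sym (pairCofactor-diag a)))
    by-cases (no a≢b)  = subst (λ b → pairCofactor R b a ≡ - pairCofactor R a b)
      (FinP.punchIn-punchOut a≢b) (pairCofactor-antisym-punchIn a (punchOut a≢b))

pairForm : ∀ {n} → (Fin n → Fin n → ℤ) → (Fin n → ℤ) → (Fin n → ℤ) → ℤ
pairForm W x y = sum (λ a → sum (λ b → x a * y b * W a b))

pairForm-antisym : ∀ {n} (W : Fin n → Fin n → ℤ) → (∀ a b → W b a ≡ - W a b) →
  ∀ x y → pairForm W y x ≡ - pairForm W x y
pairForm-antisym W W-antisym x y = begin
  sum (λ a → sum (λ b → y a * x b * W a b))
    ≡⟨ ∑-comm (λ a b → y a * x b * W a b) ⟩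
  sum (λ b → sum (λ a → y a * x b * W a b))
    ≡⟨ sum-cong-≗ (λ b → sum-cong-≗ λ a → trans (cong (y a * x b *_) (W-antisym b a)) (flip (y a) (x b) (W b a))) ⟩
  sum (λ b → sum (λ a → - + 1 * (x b * y a * W b a)))
    ≡⟨ sum-cong-≗ (λ b → sym (*-distribˡ-sum (- + 1) (λ a → x b * y a * W b a))) ⟩
  sum (λ b → - + 1 * sum (λ a → x b * y a * W b a))
    ≡⟨ sym (*-distribˡ-sum (- + 1) (λ b → sum (λ a → x b * y a * W b a))) ⟩
  - + 1 * pairForm W x y
    ≡⟨ ℤP.-1*i≡-i (pairForm W x y) ⟩
  - pairForm W x y ∎
  where
  open ≡-Reasoning
  flip : ∀ p q w → p * q * - w ≡ - + 1 * (q * p * w)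
  flip = solve-∀

lowerRows : ∀ {n} → Matrix (suc (suc n)) → Fin n → Fin (suc (suc n)) → ℤ
lowerRows M r = M (suc (suc r))

det-pairExpansion : ∀ {n} (M : Matrix (suc (suc n))) →
  det M ≡ pairForm (pairCofactor (lowerRows M)) (M zero) (M (suc zero))
det-pairExpansion {n} M = trans (det-expansion M) (sum-cong-≗ row₀-term)
  where
  open ≡-Reasoning
  P : Fin (suc (suc n)) → Fin (suc (suc n)) → ℤ
  P = pairCofactor (lowerRows M)
  x y : Fin (suc (suc n)) → ℤ
  x = M zero
  y = M (suc zero)
  D : Fin (suc (suc n)) → Fin (suc n) → ℤ
  D a c = det (minor (minor M a) c)
  row₀-term : ∀ a → x a * cofactor M a ≡ sum (λ b → x a * y b * P a b)
  row₀-term a = begin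
    x a * (sgn (toℕ a) * det (minor M a))
      ≡⟨ cong (λ d → x a * (sgn (toℕ a) * d)) (det-expansion (minor M a)) ⟩
    x a * (sgn (toℕ a) * sum (λ c → y (punchIn a c) * cofactor (minor M a) c))
      ≡⟨ sym (ℤP.*-assoc (x a) (sgn (toℕ a)) _) ⟩
    x a * sgn (toℕ a) * sum (λ c → y (punchIn a c) * cofactor (minor M a) c)
      ≡⟨ *-distribˡ-sum (x a * sgn (toℕ a)) (λ c → y (punchIn a c) * cofactor (minor M a) c) ⟩
    sum (λ c → x a * sgn (toℕ a) * (y (punchIn a c) * (sgn (toℕ c) * D a c)))
      ≡⟨ sum-cong-≗ (λ c → trans (reorder (x a) (sgn (toℕ a)) (y (punchIn a c)) (sgn (toℕ c)) (D a c))
                                (cong (x a * y (punchIn a c) *_) (sym (pairCofactor-punchIn (lowerRows M) a c)))) ⟩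
    sum (λ c → x a * y (punchIn a c) * P a (punchIn a c))
      ≡⟨ sym (ℤP.+-identityˡ _) ⟩
    + 0 + sum (λ c → x a * y (punchIn a c) * P a (punchIn a c))
      ≡⟨ cong (_+ sum (λ c → x a * y (punchIn a c) * P a (punchIn a c)))
           (sym (trans (cong (x a * y a *_) (pairCofactor-diag (lowerRows M) a)) (ℤP.*-zeroʳ (x a * y a)))) ⟩
    x a * y a * P a a + sum (λ c → x a * y (punchIn a c) * P a (punchIn a c))
      ≡⟨ sym (sum-remove (λ b → x a * y b * P a b)) ⟩
    sum (λ b → x a * y b * P a b) ∎
    where
    reorder : ∀ x s y t d → x * s * (y * (t * d)) ≡ x * y * (s * (t * d))
    reorder = solve-∀

swap₀₁ : ∀ {n} → Matrix (suc (suc n)) → Matrix (suc (suc n))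
swap₀₁ M zero          = M (suc zero)
swap₀₁ M (suc zero)    = M zero
swap₀₁ M (suc (suc i)) = M (suc (suc i))

det-swap₀₁ : ∀ {n} (M : Matrix (suc (suc n))) → det (swap₀₁ M) ≡ - det M
det-swap₀₁ {n} M = begin
  det (swap₀₁ M)
    ≡⟨ det-pairExpansion (swap₀₁ M) ⟩
  pairForm P (M (suc zero)) (M zero)
    ≡⟨ pairForm-antisym P (pairCofactor-antisym (lowerRows M)) (M zero) (M (suc zero)) ⟩
  - pairForm P (M zero) (M (suc zero))
    ≡⟨ cong -_ (sym (det-pairExpansion M)) ⟩
  - det M ∎
  where
  open ≡-Reasoning
  P : Fin (suc (suc n)) → Fin (suc (suc n)) → ℤ
  P = pairCofactor (lowerRows M)

swap₀₁-involutive : ∀ {n} (M : Matrix (suc (suc n))) i → swap₀₁ (swap₀₁ M) i ≗ M i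
swap₀₁-involutive M zero          j = refl
swap₀₁-involutive M (suc zero)    j = refl
swap₀₁-involutive M (suc (suc i)) j = refl

self-negating⇒0 : ∀ (x : ℤ) → x ≡ - x → x ≡ + 0
self-negating⇒0 (+ zero)     _  = refl
self-negating⇒0 (+ suc _)    ()
self-negating⇒0 (ℤ.negsuc _) ()

det-row₀-repeated : ∀ {n} (M : Matrix (suc (suc n))) k → M zero ≗ M (suc k) → det M ≡ + 0
det-row₀-repeated M zero same =
  self-negating⇒0 (det M) (trans (sym (det-cong swap≗M)) (det-swap₀₁ M))
  where
  swap≗M : ∀ i → swap₀₁ M i ≗ M i
  swap≗M zero          j = sym (same j)
  swap≗M (suc zero)    j = same j
  swap≗M (suc (suc i)) j = refl
det-row₀-repeated {suc n} M (suc k) same = begin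
  det M                      ≡⟨ det-cong (swap₀₁-involutive M) ⟨
  det (swap₀₁ (swap₀₁ M))    ≡⟨ det-swap₀₁ (swap₀₁ M) ⟩
  - det (swap₀₁ M)           ≡⟨ cong -_ (det-minors-vanish (swap₀₁ M) λ j →
                                  det-row₀-repeated (minor (swap₀₁ M) j) k (same ∘ punchIn j)) ⟩
  + 0                        ∎
  where open ≡-Reasoning

-- Row operations

alien-cofactors : ∀ {n} (M : Matrix (suc (suc n))) k → sum (λ j → M (suc k) j * cofactor M j) ≡ + 0
alien-cofactors M k =
  trans (sym (det-row₀≔ M (M (suc k)))) (det-row₀-repeated (M [ zero ]≔ M (suc k)) k (λ _ → refl))

det-row₀≔-add-row : ∀ {n} (M : Matrix (suc (suc n))) k {u v} → (∀ j → v j ≡ u j + M (suc k) j) →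
  det (M [ zero ]≔ v) ≡ det (M [ zero ]≔ u)
det-row₀≔-add-row M k {u} {v} v≡u+row = begin
  det (M [ zero ]≔ v)
    ≡⟨ det-row₀≔ M v ⟩
  sum (λ j → v j * cofactor M j)
    ≡⟨ sum-cong-≗ (λ j → trans (cong (_* cofactor M j) (v≡u+row j)) (ℤP.*-distribʳ-+ (cofactor M j) (u j) _)) ⟩
  sum (λ j → u j * cofactor M j + M (suc k) j * cofactor M j)
    ≡⟨ ∑-distrib-+ (λ j → u j * cofactor M j) (λ j → M (suc k) j * cofactor M j) ⟩
  sum (λ j → u j * cofactor M j) + sum (λ j → M (suc k) j * cofactor M j)
    ≡⟨ cong (_+_ (sum (λ j → u j * cofactor M j))) (alien-cofactors M k) ⟩
  sum (λ j → u j * cofactor M j) + + 0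
    ≡⟨ ℤP.+-identityʳ _ ⟩
  sum (λ j → u j * cofactor M j)
    ≡⟨ det-row₀≔ M u ⟨
  det (M [ zero ]≔ u) ∎
  where open ≡-Reasoning

det-row₀≔-columnSums : ∀ {n} (M : Matrix (suc (suc n))) → det (M [ zero ]≔ (λ j → sum (λ i → M i j))) ≡ det M
det-row₀≔-columnSums M = begin
  det (M [ zero ]≔ (λ j → sum (λ i → M i j)))
    ≡⟨ det-row₀≔ M (λ j → sum (λ i → M i j)) ⟩
  sum (λ j → sum (λ i → M i j) * cofactor M j)
    ≡⟨ sum-cong-≗ (λ j → *-distribʳ-sum (cofactor M j) (λ i → M i j)) ⟩
  sum (λ j → sum (λ i → M i j * cofactor M j))
    ≡⟨ ∑-comm (λ j i → M i j * cofactor M j) ⟩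
  sum (λ j → M zero j * cofactor M j) + sum (λ k → sum (λ j → M (suc k) j * cofactor M j))
    ≡⟨ cong (_+_ (sum (λ j → M zero j * cofactor M j))) (sum-zero (alien-cofactors M)) ⟩
  sum (λ j → M zero j * cofactor M j) + + 0
    ≡⟨ ℤP.+-identityʳ _ ⟩
  sum (λ j → M zero j * cofactor M j)
    ≡⟨ det-expansion M ⟨
  det M ∎
  where open ≡-Reasoning

det-add-row₀ : ∀ {n} (M : Matrix (suc n)) k c → det (M [ suc k ]≔ (λ j → M (suc k) j + c * M zero j)) ≡ det M
det-add-row₀ {suc n} M k c = begin
  det (M [ suc k ]≔ (λ j → M (suc k) j + c * M zero j))
    ≡⟨ det-linear M (suc k) (M (suc k)) (M zero) c ⟩
  det (M [ suc k ]≔ M (suc k)) + c * det (M [ suc k ]≔ M zero)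
    ≡⟨ cong₂ (λ x y → x + c * y) (det-cong unchanged) (det-row₀-repeated (M [ suc k ]≔ M zero) k repeated) ⟩
  det M + c * + 0
    ≡⟨ trans (cong (_+_ (det M)) (ℤP.*-zeroʳ c)) (ℤP.+-identityʳ (det M)) ⟩
  det M ∎
  where
  open ≡-Reasoning
  unchanged : ∀ i → (M [ suc k ]≔ M (suc k)) i ≗ M i
  unchanged i = cong-app (updateAt-id-local (suc k) M refl i)
  repeated : M zero ≗ (M [ suc k ]≔ M zero) (suc k)
  repeated j = sym (cong-app (updateAt-updates (suc k) M) j)

shear : ∀ {n} → (Fin n → ℤ) → Matrix (suc n) → Matrix (suc n)
shear c M zero    = M zero
shear c M (suc i) = λ j → M (suc i) j + c i * M zero j

module _ {n} (M : Matrix (suc n)) where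

  shear-step : ∀ (c : Fin n → ℤ) k → let c′ = updateAt c k (const (+ 0)) in
    ∀ i → shear c M i ≗ (shear c′ M [ suc k ]≔ (λ j → shear c′ M (suc k) j + c k * M zero j)) i
  shear-step c k zero    j = refl
  shear-step c k (suc i) j with i Fin.≟ k
  ... | yes refl = sym (begin
    updateAt (shear c′ M) (suc i) (const row) (suc i) j
      ≡⟨ cong-app (updateAt-updates (suc i) (shear c′ M)) j ⟩
    M (suc i) j + c′ i * M zero j + c i * M zero j
      ≡⟨ cong (λ a → M (suc i) j + a * M zero j + c i * M zero j) (updateAt-updates i c) ⟩
    M (suc i) j + + 0 * M zero j + c i * M zero j
      ≡⟨ drop-zero (M (suc i) j) (M zero j) (c i * M zero j) ⟩
    M (suc i) j + c i * M zero j ∎)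
    where
    open ≡-Reasoning
    c′ : Fin n → ℤ
    c′ = updateAt c i (const (+ 0))
    row : Fin (suc n) → ℤ
    row j = shear c′ M (suc i) j + c i * M zero j
    drop-zero : ∀ m x y → m + + 0 * x + y ≡ m + y
    drop-zero = solve-∀
  ... | no i≢k = sym (trans (cong-app (updateAt-minimal (suc i) (suc k) (shear c′ M) (i≢k ∘ FinP.suc-injective)) j)
                            (cong (λ a → M (suc i) j + a * M zero j) (updateAt-minimal i k c i≢k)))
    where c′ = updateAt c k (const (+ 0))

  det-shear-indicatorBelow : ∀ t (c : Fin n → ℤ) → (∀ i → t ℕ.≤ toℕ i → c i ≡ + 0) → det (shear c M) ≡ det M
  det-shear-indicatorBelow zero c c≡0 = det-cong unsheared
    where
    unsheared : ∀ i → shear c M i ≗ M i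
    unsheared zero    j = refl
    unsheared (suc i) j = trans (cong (λ a → M (suc i) j + a * M zero j) (c≡0 i ℕ.z≤n))
                                (trans (cong (_+_ (M (suc i) j)) (ℤP.*-zeroˡ (M zero j))) (ℤP.+-identityʳ _))
  det-shear-indicatorBelow (suc t) c c≡0 with t ℕ.<? n
  ... | no t≮n = det-shear-indicatorBelow t c (λ i t≤i → contradiction (ℕP.≤-<-trans t≤i (FinP.toℕ<n i)) t≮n)
  ... | yes t<n = begin
    det (shear c M)                        ≡⟨ det-cong (shear-step c k) ⟩
    det (shear c′ M [ suc k ]≔ _)         ≡⟨ det-add-row₀ (shear c′ M) k (c k) ⟩
    det (shear c′ M)                       ≡⟨ det-shear-indicatorBelow t c′ c′≡0 ⟩
    det M                                  ∎
    where
    open ≡-Reasoning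
    k : Fin n
    k = Fin.fromℕ< t<n
    c′ : Fin n → ℤ
    c′ = updateAt c k (const (+ 0))
    c′≡0 : ∀ i → t ℕ.≤ toℕ i → c′ i ≡ + 0
    c′≡0 i t≤i with i Fin.≟ k
    ... | yes refl = updateAt-updates i c
    ... | no i≢k  = trans (updateAt-minimal i k c i≢k) (c≡0 i (ℕP.≤∧≢⇒< t≤i t≢i))
      where
      t≢i : t ≢ toℕ i
      t≢i t≡i = i≢k (FinP.toℕ-injective (trans (sym t≡i) (sym (FinP.toℕ-fromℕ< t<n))))

  det-shear : ∀ c → det (shear c M) ≡ det M
  det-shear c = det-shear-indicatorBelow n c (λ i n≤i → contradiction (FinP.toℕ<n i) (ℕP.≤⇒≯ n≤i))

𝟙 : ∀ {P : Set} → Dec P → ℤ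
𝟙 P? = if does P? then + 1 else + 0

module _ {P : Set} (P? : Dec P) where

  𝟙-yes : P → 𝟙 P? ≡ + 1
  𝟙-yes p = cong (if_then + 1 else + 0) (dec-true P? p)

  𝟙-no : ¬ P → 𝟙 P? ≡ + 0
  𝟙-no ¬p = cong (if_then + 1 else + 0) (dec-false P? ¬p)

𝟙-cong : ∀ {P Q : Set} (P? : Dec P) (Q? : Dec Q) → (P → Q) → (Q → P) → 𝟙 P? ≡ 𝟙 Q?
𝟙-cong (yes p) Q? P→Q Q→P = sym (𝟙-yes Q? (P→Q p))
𝟙-cong (no ¬p) Q? P→Q Q→P = sym (𝟙-no Q? (¬p ∘ Q→P))

sum-𝟙-unique : ∀ {n} {P : Fin n → Set} (P? : ∀ i → Dec (P i)) a → P a → (∀ i → P i → i ≡ a) →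
  sum (λ i → 𝟙 (P? i)) ≡ + 1
sum-𝟙-unique {suc n} P? a Pa unique = begin
  sum (λ i → 𝟙 (P? i))                                  ≡⟨ sum-remove (λ i → 𝟙 (P? i)) ⟩
  𝟙 (P? a) + sum (λ c → 𝟙 (P? (punchIn a c)))          ≡⟨ cong₂ _+_ (𝟙-yes (P? a) Pa) (sum-zero λ c →
                                                             𝟙-no (P? (punchIn a c)) (FinP.punchInᵢ≢i a c ∘ unique _)) ⟩
  + 1 ∎
  where open ≡-Reasoning

sum-neg : ∀ {n} (f : Fin n → ℤ) → sum (λ i → - f i) ≡ - sum f
sum-neg f = trans (sum-cong-≗ λ i → sym (ℤP.-1*i≡-i (f i)))
  (trans (sym (*-distribˡ-sum (- + 1) f)) (ℤP.-1*i≡-i (sum f)))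

sum-ones : ∀ n → sum {n} (λ _ → + 1) ≡ + n
sum-ones zero    = refl
sum-ones (suc n) = cong (_+_ (+ 1)) (sum-ones n)

-- The mixed complete graph

suc-mod : ∀ {n} x → x ℕ.< suc n → (suc x % suc n ≡ suc x) ⊎ (x ≡ n × suc x % suc n ≡ 0)
suc-mod {n} x x<1+n with suc x ℕ.<? suc n
... | yes 1+x<1+n = inj₁ (m<n⇒m%n≡m 1+x<1+n)
... | no 1+x≮1+n = inj₂ (x≡n , trans (cong (λ y → suc y % suc n) x≡n) (n%n≡0 (suc n)))
  where
  x≡n : x ≡ n
  x≡n = ℕP.≤-antisym (ℕ.s≤s⁻¹ x<1+n) (ℕ.s≤s⁻¹ (ℕP.≮⇒≥ 1+x≮1+n))

dCArc-irreflexive : ∀ {n} → 1 ℕ.≤ n → (i : Fin (suc n)) → ¬ dCArc (suc n) i i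
dCArc-irreflexive 1≤n i ii with suc-mod (toℕ i) (FinP.toℕ<n i)
... | inj₁ wrap-free = ℕP.1+n≢n (sym (trans ii wrap-free))
... | inj₂ (i≡n , wraps) = ℕP.<⇒≢ 1≤n (sym (trans (sym i≡n) (trans ii wraps)))

dCArc-asymmetric : ∀ {n} → 2 ℕ.≤ n → (i j : Fin (suc n)) → dCArc (suc n) i j → ¬ dCArc (suc n) j i
dCArc-asymmetric 2≤n i j ij ji with suc-mod (toℕ i) (FinP.toℕ<n i) | suc-mod (toℕ j) (FinP.toℕ<n j)
... | inj₁ i↦ | inj₁ j↦ = ℕP.<⇒≢ (ℕ.s≤s (ℕP.n≤1+n _)) (trans ji (trans j↦ (cong suc (trans ij i↦))))
... | inj₂ (i≡n , i↦) | inj₁ j↦ =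
  ℕP.<⇒≢ 2≤n (sym (trans (sym i≡n) (trans ji (trans j↦ (cong suc (trans ij i↦))))))
... | inj₁ i↦ | inj₂ (j≡n , j↦) =
  ℕP.<⇒≢ 2≤n (sym (trans (sym j≡n) (trans ij (trans i↦ (cong suc (trans ji j↦))))))
... | inj₂ (i≡n , i↦) | inj₂ (j≡n , j↦) =
  ℕP.<⇒≢ (ℕP.≤-trans (ℕ.s≤s ℕ.z≤n) 2≤n) (sym (trans (sym j≡n) (trans ij i↦)))

dCArc-into-successor : ∀ {n} (j : Fin (suc n)) (i : Fin n) →
  𝟙 (dCArc? (suc n) j (suc i)) ≡ 𝟙 (toℕ j ℕ.≟ toℕ i)
dCArc-into-successor {n} j i with suc-mod (toℕ j) (FinP.toℕ<n j)
... | inj₁ j↦ = 𝟙-cong (dCArc? (suc n) j (suc i)) (toℕ j ℕ.≟ toℕ i)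
  (λ e → sym (ℕP.suc-injective (trans e j↦))) (λ e → trans (cong suc (sym e)) (sym j↦))
... | inj₂ (j≡n , j↦) = 𝟙-cong (dCArc? (suc n) j (suc i)) (toℕ j ℕ.≟ toℕ i)
  (λ e → contradiction (trans e j↦) λ ()) (λ e → contradiction (trans (sym e) j≡n) (ℕP.<⇒≢ (FinP.toℕ<n i)))

adjMK-entry : ∀ {n} → 2 ℕ.≤ n → ∀ (i j : Fin (suc n)) →
  adjMK (suc n) i j ≡ + 1 - 𝟙 (i Fin.≟ j) - 𝟙 (dCArc? (suc n) j i)
adjMK-entry {n} 2≤n i j with dCArc? (suc n) i j
... | yes ij with i Fin.≟ j | dCArc? (suc n) j i
...   | yes refl | _       = contradiction ij (dCArc-irreflexive (ℕP.<⇒≤ 2≤n) i)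
...   | no _     | yes ji  = contradiction ji (dCArc-asymmetric 2≤n i j ij)
...   | no _     | no ¬ji  = sym (cong (λ x → + 1 - + 0 - x) (𝟙-no (dCArc? (suc n) j i) ¬ji))
adjMK-entry {n} 2≤n i j | no _ with i Fin.≟ j | dCArc? (suc n) j i
...   | yes refl | yes ii  = contradiction ii (dCArc-irreflexive (ℕP.<⇒≤ 2≤n) i)
...   | yes refl | no ¬ii  = sym (cong (λ x → + 1 - + 1 - x) (𝟙-no (dCArc? (suc n) i i) ¬ii))
...   | no _     | yes ji  = sym (cong (λ x → + 1 - + 0 - x) (𝟙-yes (dCArc? (suc n) j i) ji))
...   | no _     | no ¬ji  = sym (cong (λ x → + 1 - + 0 - x) (𝟙-no (dCArc? (suc n) j i) ¬ji))

adjMK-columnSum : ∀ {m} → 2 ℕ.≤ suc m → ∀ j → sum (λ i → adjMK (suc (suc m)) i j) ≡ + m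
adjMK-columnSum {m} 2≤N-1 j = begin
  sum (λ i → adjMK N i j)
    ≡⟨ sum-cong-≗ (λ i → adjMK-entry 2≤N-1 i j) ⟩
  sum (λ i → + 1 - 𝟙 (i Fin.≟ j) - 𝟙 (dCArc? N j i))
    ≡⟨ ∑-distrib-+ (λ i → + 1 - 𝟙 (i Fin.≟ j)) (λ i → - 𝟙 (dCArc? N j i)) ⟩
  sum (λ i → + 1 - 𝟙 (i Fin.≟ j)) + sum (λ i → - 𝟙 (dCArc? N j i))
    ≡⟨ cong₂ _+_ (∑-distrib-+ (λ _ → + 1) (λ i → - 𝟙 (i Fin.≟ j))) (sum-neg (λ i → 𝟙 (dCArc? N j i))) ⟩
  sum {N} (λ _ → + 1) + sum (λ i → - 𝟙 (i Fin.≟ j)) - sum (λ i → 𝟙 (dCArc? N j i))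
    ≡⟨ cong₂ (λ x y → x + y - sum (λ i → 𝟙 (dCArc? N j i))) (sum-ones N) (sum-neg (λ i → 𝟙 (i Fin.≟ j))) ⟩
  + N - sum (λ i → 𝟙 (i Fin.≟ j)) - sum (λ i → 𝟙 (dCArc? N j i))
    ≡⟨ cong₂ (λ x y → + N - x - y) (sum-𝟙-unique (Fin._≟ j) j refl (λ _ i≡j → i≡j))
         (sum-𝟙-unique (dCArc? N j) successor (FinP.toℕ-fromℕ< x<N)
           (λ i ji → FinP.toℕ-injective (trans ji (sym (FinP.toℕ-fromℕ< x<N))))) ⟩
  + N - + 1 - + 1
    ≡⟨ refl ⟩
  + m ∎
  where
  open ≡-Reasoning
  N : ℕ
  N = suc (suc m)
  x<N : suc (toℕ j) % N ℕ.< N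
  x<N = m%n<n (suc (toℕ j)) N
  successor : Fin N
  successor = Fin.fromℕ< x<N

-- A(mK_n) with its first row replaced by ones, which is then subtracted from the other rows.
reducedAdj : ∀ {n} → Matrix n
reducedAdj zero    j = + 1
reducedAdj (suc i) j = - 𝟙 (toℕ j ℕ.≟ suc (toℕ i)) - 𝟙 (toℕ j ℕ.≟ toℕ i)

adjMK-lowerRow : ∀ {n} → 2 ℕ.≤ n → ∀ (i : Fin n) j →
  adjMK (suc n) (suc i) j ≡ reducedAdj (suc i) j + + 1 * reducedAdj {suc n} zero j
adjMK-lowerRow {n} 2≤n i j = begin
  adjMK (suc n) (suc i) j
    ≡⟨ adjMK-entry 2≤n (suc i) j ⟩
  + 1 - 𝟙 (suc i Fin.≟ j) - 𝟙 (dCArc? (suc n) j (suc i))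
    ≡⟨ cong₂ (λ x y → + 1 - x - y)
         (𝟙-cong (suc i Fin.≟ j) (toℕ j ℕ.≟ suc (toℕ i)) (λ e → cong toℕ (sym e)) (λ e → sym (FinP.toℕ-injective e)))
         (dCArc-into-successor j i) ⟩
  + 1 - 𝟙 (toℕ j ℕ.≟ suc (toℕ i)) - 𝟙 (toℕ j ℕ.≟ toℕ i)
    ≡⟨ shift (𝟙 (toℕ j ℕ.≟ suc (toℕ i))) (𝟙 (toℕ j ℕ.≟ toℕ i)) ⟩
  reducedAdj (suc i) j + + 1 * + 1 ∎
  where
  open ≡-Reasoning
  shift : ∀ x y → + 1 - x - y ≡ - x - y + + 1 * + 1
  shift = solve-∀

det-adjMK : ∀ {m} → 2 ℕ.≤ suc m → det (adjMK (suc (suc m))) ≡ + m * det (reducedAdj {suc (suc m)})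
det-adjMK {m} 2≤N-1 = begin
  det A
    ≡⟨ det-row₀≔-columnSums A ⟨
  det (A [ zero ]≔ (λ j → sum (λ i → A i j)))
    ≡⟨ det-row₀≔-cong A (λ j → trans (adjMK-columnSum 2≤N-1 j) (sym (ℤP.*-identityʳ (+ m)))) ⟩
  det (A [ zero ]≔ (λ _ → + m * + 1))
    ≡⟨ det-row₀≔-scale A (+ m) (λ _ → + 1) ⟩
  + m * det (A [ zero ]≔ (λ _ → + 1))
    ≡⟨ cong (+ m *_) (det-cong sheared) ⟩
  + m * det (shear (λ _ → + 1) B)
    ≡⟨ cong (+ m *_) (det-shear B (λ _ → + 1)) ⟩
  + m * det B ∎
  where
  open ≡-Reasoning
  A B : Matrix (suc (suc m))
  A = adjMK (suc (suc m))
  B = reducedAdj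
  sheared : ∀ i → (A [ zero ]≔ (λ _ → + 1)) i ≗ shear (λ _ → + 1) B i
  sheared zero    j = refl
  sheared (suc i) j = adjMK-lowerRow 2≤N-1 i j

indicatorBelow : ∀ {n} → ℕ → Fin n → ℤ
indicatorBelow t j = 𝟙 (toℕ j ℕ.<? t)

indicatorBelow-step : ∀ x t → 𝟙 (x ℕ.<? t) ≡ 𝟙 (x ℕ.<? suc (suc t)) + (- 𝟙 (x ℕ.≟ suc t) - 𝟙 (x ℕ.≟ t))
indicatorBelow-step zero          zero    = refl
indicatorBelow-step zero          (suc t) = refl
indicatorBelow-step (suc zero)    zero    = refl
indicatorBelow-step (suc (suc x)) zero    = refl
indicatorBelow-step (suc x)       (suc t) = indicatorBelow-step x t

module _ {m : ℕ} where

  private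
    N : ℕ
    N = suc (suc m)
    B : Matrix N
    B = reducedAdj

  det-reducedAdj-row₀≔indicatorBelow : ∀ k t → t ℕ.+ k ℕ.* 2 ≡ N → det (B [ zero ]≔ indicatorBelow t) ≡ det B
  det-reducedAdj-row₀≔indicatorBelow zero t t+0≡N = det-cong {M = B [ zero ]≔ indicatorBelow t} {N = B} λ
    { zero j → 𝟙-yes (toℕ j ℕ.<? t) (subst (toℕ j ℕ.<_) (sym (trans (sym (ℕP.+-identityʳ t)) t+0≡N)) (FinP.toℕ<n j))
    ; (suc i) j → refl }
  det-reducedAdj-row₀≔indicatorBelow (suc k) t t+2+2k≡N = begin
    det (B [ zero ]≔ indicatorBelow t)
      ≡⟨ det-row₀≔-add-row B r {indicatorBelow (suc (suc t))} (λ j → trans (indicatorBelow-step (toℕ j) t) (row-r j)) ⟩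
    det (B [ zero ]≔ indicatorBelow (suc (suc t)))
      ≡⟨ det-reducedAdj-row₀≔indicatorBelow k (suc (suc t)) 2+t+2k≡N ⟩
    det B ∎
    where
    open ≡-Reasoning
    2+t+2k≡N : suc (suc t) ℕ.+ k ℕ.* 2 ≡ N
    2+t+2k≡N = trans (sym (trans (ℕP.+-suc t _) (cong suc (ℕP.+-suc t _)))) t+2+2k≡N
    t<N-1 : t ℕ.< suc m
    t<N-1 = ℕ.s≤s⁻¹ (subst (suc (suc t) ℕ.≤_) 2+t+2k≡N (ℕP.m≤m+n (suc (suc t)) (k ℕ.* 2)))
    r : Fin (suc m)
    r = Fin.fromℕ< t<N-1
    row-r : ∀ j → indicatorBelow (suc (suc t)) j + (- 𝟙 (toℕ j ℕ.≟ suc t) - 𝟙 (toℕ j ℕ.≟ t))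
                     ≡ indicatorBelow (suc (suc t)) j + B (suc r) j
    row-r j = cong (λ s → indicatorBelow (suc (suc t)) j + (- 𝟙 (toℕ j ℕ.≟ suc s) - 𝟙 (toℕ j ℕ.≟ s)))
                        (sym (FinP.toℕ-fromℕ< t<N-1))

  det-reducedAdj-even : ∀ k → k ℕ.* 2 ≡ N → det B ≡ + 0
  det-reducedAdj-even k 2k≡N = begin
    det B                               ≡⟨ det-reducedAdj-row₀≔indicatorBelow k 0 2k≡N ⟨
    det (B [ zero ]≔ indicatorBelow 0)  ≡⟨ det-row₀≔ B (indicatorBelow 0) ⟩
    sum (λ j → + 0 * cofactor B j)      ≡⟨ sum-zero (λ j → ℤP.*-zeroˡ (cofactor B j)) ⟩
    + 0                                 ∎
    where open ≡-Reasoning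

  det-reducedAdj-odd : ∀ k → 1 ℕ.+ k ℕ.* 2 ≡ N → det B ≡ + 1
  det-reducedAdj-odd k 1+2k≡N = begin
    det B
      ≡⟨ det-reducedAdj-row₀≔indicatorBelow k 1 1+2k≡N ⟨
    det (B [ zero ]≔ indicatorBelow 1)
      ≡⟨ det-row₀≔ B (indicatorBelow 1) ⟩
    + 1 * (+ 1 * det (minor B zero)) + sum (λ j → + 0 * cofactor B (suc j))
      ≡⟨ cong₂ _+_ (trans (ℤP.*-identityˡ (+ 1 * det (minor B zero))) (ℤP.*-identityˡ (det (minor B zero))))
                   (sum-zero (λ j → ℤP.*-zeroˡ (cofactor B (suc j)))) ⟩
    det (minor B zero) + + 0
      ≡⟨ ℤP.+-identityʳ (det (minor B zero)) ⟩
    det (minor B zero)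
      ≡⟨ det-lowerTriangular (- + 1) (minor B zero) diagonal upper ⟩
    (- + 1) ℤ.^ suc m
      ≡⟨ cong ((- + 1) ℤ.^_) (trans (ℕP.suc-injective (sym 1+2k≡N)) (ℕP.*-comm k 2)) ⟩
    (- + 1) ℤ.^ (2 ℕ.* k)
      ≡⟨ ℤP.^-*-assoc (- + 1) 2 k ⟨
    (+ 1) ℤ.^ k
      ≡⟨ ℤP.^-zeroˡ k ⟩
    + 1 ∎
    where
    open ≡-Reasoning
    diagonal : ∀ i → minor B zero i i ≡ - + 1
    diagonal i = cong₂ (λ x y → - x - y) (𝟙-yes (suc (toℕ i) ℕ.≟ suc (toℕ i)) refl)
                                          (𝟙-no (suc (toℕ i) ℕ.≟ toℕ i) ℕP.1+n≢n)
    upper : ∀ i j → i Fin.< j → minor B zero i j ≡ + 0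
    upper i j i<j = cong₂ (λ x y → - x - y)
      (𝟙-no (suc (toℕ j) ℕ.≟ suc (toℕ i)) (ℕP.>⇒≢ i<j ∘ ℕP.suc-injective))
      (𝟙-no (suc (toℕ j) ℕ.≟ toℕ i) (ℕP.>⇒≢ (ℕP.m<n⇒m<1+n i<j)))

odd-decomposition : ∀ n → ¬ 2 ∣ n → 1 ℕ.+ (n / 2) ℕ.* 2 ≡ n
odd-decomposition n 2∤n with n % 2 | m%n<n n 2 | m%n≡0⇒n∣m n 2 | m≡m%n+[m/n]*n n 2
... | zero        | _                 | 2∣n | _       = contradiction (2∣n refl) 2∤n
... | suc zero    | _                 | _   | n≡1+2k = sym n≡1+2k
... | suc (suc _) | ℕ.s≤s (ℕ.s≤s ()) | _   | _

det-adjMK-even : ∀ {m} → 2 ℕ.≤ suc m → 2 ∣ suc (suc m) → det (adjMK (suc (suc m))) ≡ + 0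
det-adjMK-even {m} 2≤m+1 (divides q N≡q*2) = begin
  det (adjMK (suc (suc m)))             ≡⟨ det-adjMK 2≤m+1 ⟩
  + m * det (reducedAdj {suc (suc m)})  ≡⟨ cong (+ m *_) (det-reducedAdj-even q (sym N≡q*2)) ⟩
  + m * + 0                             ≡⟨ ℤP.*-zeroʳ (+ m) ⟩
  + 0                                   ∎
  where open ≡-Reasoning

det-adjMK-odd : ∀ {m} → 2 ℕ.≤ suc m → ¬ 2 ∣ suc (suc m) → det (adjMK (suc (suc m))) ≡ + m
det-adjMK-odd {m} 2≤m+1 2∤N = begin
  det (adjMK (suc (suc m)))
    ≡⟨ det-adjMK 2≤m+1 ⟩
  + m * det (reducedAdj {suc (suc m)})
    ≡⟨ cong (+ m *_) (det-reducedAdj-odd (suc (suc m) / 2) (odd-decomposition (suc (suc m)) 2∤N)) ⟩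
  + m * + 1
    ≡⟨ ℤP.*-identityʳ (+ m) ⟩
  + m ∎
  where open ≡-Reasoning

theorem11 : (n : ℕ) → n > 3 →
    (2 ∣ n → det (adjMK n) ≡ + 0) × (¬ (2 ∣ n) → det (adjMK n) ≡ + (n ∸ 2))
theorem11 (suc (suc (suc (suc k)))) (ℕ.s≤s (ℕ.s≤s (ℕ.s≤s (ℕ.s≤s _)))) =
  det-adjMK-even 2≤m+1 , det-adjMK-odd 2≤m+1
  where
  2≤m+1 : 2 ℕ.≤ suc (suc (suc k))
  2≤m+1 = ℕ.s≤s (ℕ.s≤s ℕ.z≤n)
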